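{- Let $(a,b,c,\dots,m)$ be a tuple of positive integers with at least two terms, first term $a$, second term $b>1$ and last term $m$, with $a\ge m$. Then the number of jumps of order 1 that can be successively applied to it is $a-m$, and hence the jump set of order 1 of this tuple has exactly $a-m+1$ elements.
   Context: Partitions are written as finite ordered tuples of positive integers. For an integer $r\ge 1$, a jump of order $r$ transforms a tuple $(a_1,a_2,\dots,a_k)$ into $(a_1-r,\,r,\,a_2,\dots,a_k)$; it is allowed only when $a_1-r$ is not less than the last term of the resulting tuple and $r$ is not greater than any of the terms $a_2,\dots,a_k$. The jump set of order 1 of a tuple is the set consisting of the tuple itself together with all tuples obtained from it by repeated (successive) application of jumps of order 1. -}

module Defs where

open import Data.Nat using (ℕ; zero; suc; _≤_; _∸_)
open import Data.List using (List; []; _∷_)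
open import Data.List.Relation.Unary.All using (All)
open import Relation.Binary.Construct.Closure.ReflexiveTransitive using (Star)

-- A tuple (partition) is a finite list of natural numbers; positivity is
-- imposed as a hypothesis where needed.
Tuple : Set
Tuple = List ℕ

lastOf : ℕ → List ℕ → ℕ
lastOf x []       = x
lastOf x (y ∷ ys) = lastOf y ys

-- A jump of order r: (a₁ , a₂ , … , a_k) ↦ (a₁ - r , r , a₂ , … , a_k),
-- allowed when a₁ - r ≥ last term of the result and r ≤ a_i for i ≥ 2.
-- (r ≤ a₁ just makes the truncated subtraction ∸ the genuine one; it is
-- implied by a₁ - r ≥ last term ≥ 1 for positive tuples.)
data Jump (r : ℕ) : Tuple → Tuple → Set where
  jump : ∀ {a rest} → r ≤ a → lastOf r rest ≤ a ∸ r → All (r ≤_) rest →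
         Jump r (a ∷ rest) ((a ∸ r) ∷ r ∷ rest)

data Jumps1 : ℕ → Tuple → Tuple → Set where
  done : ∀ {t} → Jumps1 zero t t
  step : ∀ {n t u v} → Jump 1 t u → Jumps1 n u v → Jumps1 (suc n) t v

InJumpSet1 : Tuple → Tuple → Set
InJumpSet1 t u = Star (Jump 1) t u

{-# OPTIONS --safe #-}
-- A jump of order 1 from (x , t) is possible exactly when the last term m of
-- the result satisfies m ≤ x − 1, and it leads to (x − 1 , 1 , t).  The new
-- tail 1 ∷ t is again positive and ends in m, so jumps of order 1 are
-- deterministic and merely lower the first term by one as long as it exceeds
-- m.  Hence exactly x − m jumps can be made, and the jump set is the chain
-- (x − i , 1 , … , 1 , t) with i ones, for i = 0 , … , x − m.
module Submission where

open import Defs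
open import Data.Nat using (ℕ; zero; suc; _+_; _<_; _≤_; _∸_; z≤n; s≤s)
open import Data.Nat.Properties using (m≤n+m; m∸n+n≡m; ≤-reflexive; ≤-trans; <-irrefl; n≮n; n≤1+n)
open import Data.List using (List; []; _∷_; length)
open import Data.List.Relation.Unary.All using (All; []; _∷_)
open import Data.List.Relation.Unary.All.Properties using (¬Any⇒All¬)
open import Data.List.Relation.Unary.Any using (here; there)
open import Data.List.Relation.Unary.AllPairs using ([]; _∷_)
open import Data.List.Relation.Unary.Unique.Propositional using (Unique)
open import Data.List.Membership.Propositional using (_∈_; _∉_)
open import Data.Product using (Σ; ∃; _×_; _,_)
open import Relation.Nullary using (¬_; contradiction)
open import Relation.Binary.PropositionalEquality using (_≡_; refl; cong)
open import Relation.Binary.Construct.Closure.ReflexiveTransitive using (Star; ε; _◅_)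
open import Function.Bundles using (_⇔_; mk⇔)

-- For a tail t, lastOf 1 t is the last term of (x ∷ t) once a jump of order 1
-- has prepended a 1; since lastOf 1 (1 ∷ t) reduces to lastOf 1 t, it is
-- invariant along jumps of order 1.
jump₁ : ∀ {x t} → All (0 <_) t → lastOf 1 t ≤ x → Jump 1 (suc x ∷ t) (x ∷ 1 ∷ t)
jump₁ pos m≤x = jump (s≤s z≤n) m≤x pos

jump₁-impossible : ∀ {x t u} → x ≤ lastOf 1 t → ¬ Jump 1 (x ∷ t) u
jump₁-impossible x≤m (jump (s≤s z≤n) m≤x∸1 _) = n≮n _ (≤-trans (s≤s m≤x∸1) x≤m)

jumps₁-possible : ∀ n {x t} → All (0 <_) t → n + lastOf 1 t ≤ x → ∃ (Jumps1 n (x ∷ t))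
jumps₁-possible zero    pos _           = _ , done
jumps₁-possible (suc n) pos (s≤s n+m≤x) =
  let u , js = jumps₁-possible n (s≤s z≤n ∷ pos) n+m≤x
  in  u , step (jump₁ pos (≤-trans (m≤n+m _ n) n+m≤x)) js

jumps₁-bound : ∀ n {x t u} → Jumps1 (suc n) (x ∷ t) u → suc n + lastOf 1 t ≤ x
jumps₁-bound zero    (step (jump (s≤s z≤n) m≤x∸1 _) _)  = s≤s m≤x∸1
jumps₁-bound (suc n) (step (jump (s≤s z≤n) _ _)     js) = s≤s (jumps₁-bound n js)

orbit₁ : ℕ → List ℕ → List Tuple
orbit₁ zero    t = (lastOf 1 t ∷ t) ∷ []
orbit₁ (suc n) t = (suc n + lastOf 1 t ∷ t) ∷ orbit₁ n (1 ∷ t)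

length-orbit₁ : ∀ n t → length (orbit₁ n t) ≡ suc n
length-orbit₁ zero    t = refl
length-orbit₁ (suc n) t = cong suc (length-orbit₁ n (1 ∷ t))

∉-orbit₁ : ∀ n t {y ys} → n + lastOf 1 t < y → (y ∷ ys) ∉ orbit₁ n t
∉-orbit₁ zero    t lt (here refl) = n≮n _ lt
∉-orbit₁ (suc n) t lt (here refl) = n≮n _ lt
∉-orbit₁ (suc n) t lt (there u∈)  = ∉-orbit₁ n (1 ∷ t) (≤-trans (n≤1+n _) lt) u∈

orbit₁-unique : ∀ n t → Unique (orbit₁ n t)
orbit₁-unique zero    t = [] ∷ []
orbit₁-unique (suc n) t =
  ¬Any⇒All¬ _ (∉-orbit₁ n (1 ∷ t) (s≤s (≤-reflexive refl))) ∷ orbit₁-unique n (1 ∷ t)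

∈-orbit₁⇒reachable : ∀ n {t u} → All (0 <_) t → u ∈ orbit₁ n t → Star (Jump 1) (n + lastOf 1 t ∷ t) u
∈-orbit₁⇒reachable zero    pos (here refl) = ε
∈-orbit₁⇒reachable (suc n) pos (here refl) = ε
∈-orbit₁⇒reachable (suc n) pos (there u∈)  =
  jump₁ pos (m≤n+m _ n) ◅ ∈-orbit₁⇒reachable n (s≤s z≤n ∷ pos) u∈

reachable⇒∈-orbit₁ : ∀ n {t u} → Star (Jump 1) (n + lastOf 1 t ∷ t) u → u ∈ orbit₁ n t
reachable⇒∈-orbit₁ zero    ε                 = here refl
reachable⇒∈-orbit₁ (suc n) ε                 = here refl
reachable⇒∈-orbit₁ zero    (j ◅ _)           = contradiction j (jump₁-impossible (≤-reflexive refl))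
reachable⇒∈-orbit₁ (suc n) (jump _ _ _ ◅ js) = there (reachable⇒∈-orbit₁ n js)

jumpSet₁≡orbit₁ : ∀ n {x t} → All (0 <_) t → n + lastOf 1 t ≡ x →
                  ∀ u → (u ∈ orbit₁ n t) ⇔ InJumpSet1 (x ∷ t) u
jumpSet₁≡orbit₁ n pos refl u = mk⇔ (∈-orbit₁⇒reachable n pos) (reachable⇒∈-orbit₁ n)

-- The hypothesis 1 < b only matters for jumps of higher order.
mainTheorem4 : (a b : ℕ) (rest : List ℕ) →
    All (0 <_) (a ∷ b ∷ rest) → 1 < b → lastOf b rest ≤ a →
    ((∃ λ u → Jumps1 (a ∸ lastOf b rest) (a ∷ b ∷ rest) u)
    × (∀ u → ¬ Jumps1 (suc (a ∸ lastOf b rest)) (a ∷ b ∷ rest) u))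
    × (Σ (List Tuple) λ L → length L ≡ suc (a ∸ lastOf b rest) × Unique L
    × (∀ u → (u ∈ L) ⇔ InJumpSet1 (a ∷ b ∷ rest) u))
mainTheorem4 a b rest (_ ∷ pos) _ m≤a =
    ( jumps₁-possible n pos (≤-reflexive n+m≡a)
    , λ u js → <-irrefl n+m≡a (jumps₁-bound n js) )
  , orbit₁ n (b ∷ rest) , length-orbit₁ n _ , orbit₁-unique n _ , jumpSet₁≡orbit₁ n pos n+m≡a
  where
  n : ℕ
  n = a ∸ lastOf b rest
  n+m≡a : n + lastOf b rest ≡ a
  n+m≡a = m∸n+n≡m m≤a
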